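{- For all integers $n\ge k\ge1$, \[B_{n,k}=\binom nk\widehat P_{n-k,k}\Big(\tfrac{X_1}{1},\tfrac{X_2}{2},\ldots,\tfrac{X_{n-k+1}}{n-k+1}\Big).\]
   Context: $\mathbb{K}$ is a field of characteristic zero. Partial Bell polynomials: $B_{0,0}=1$, $B_{n,0}=0$ ($n\ge1$), $B_{n,k}=0$ ($k>n$), and for $1\le k\le n$, $B_{n,k}=\sum\frac{n!}{\prod_ir_i!(i!)^{r_i}}\prod_iX_i^{r_i}$ over non-negative integers with $\sum r_i=k$, $\sum ir_i=n$. Potential polynomials $\widehat P_{m,r}:=\sum_{j=0}^mr(r-1)\cdots(r-j+1)X_0^{r-j}B_{m,j}$ ($m\ge0$, $r\in\mathbb{Z}$). $\widehat P_{m,r}(Y_0,Y_1,\ldots,Y_m)$ means replacing $X_i$ by $Y_i$, so here $X_0\mapsto X_1/1$, $X_1\mapsto X_2/2$, etc. -}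

module Defs where

open import Level using (Level; _⊔_)
open import Algebra.Bundles using (CommutativeRing)
open import Data.Nat as ℕ using (ℕ; zero; suc; _≟_)
open import Data.Nat using (_!)
open import Data.Integer as ℤ using (ℤ; +_; -[1+_])
open import Data.Fin using (Fin; toℕ)
open import Data.Vec as Vec using (Vec; []; _∷_)
open import Data.List as List using (List; [_]; concatMap; upTo; filter)
open import Data.Product using (_×_; proj₁; proj₂)
open import Relation.Nullary using (¬_)
open import Relation.Nullary.Decidable using (_×-dec_)

ιR : ∀ {c ℓ} (R : CommutativeRing c ℓ) → ℕ → CommutativeRing.Carrier R
ιR R zero    = CommutativeRing.0# R
ιR R (suc n) = CommutativeRing._+_ R (CommutativeRing.1# R) (ιR R n)

record CharZeroField (c ℓ : Level) : Set (Level.suc (c ⊔ ℓ)) where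
  field
    commRing : CommutativeRing c ℓ
  open CommutativeRing commRing public
  ι : ℕ → Carrier
  ι = ιR commRing
  field
    _⁻¹      : Carrier → Carrier
    inverse  : ∀ x → ¬ (x ≈ 0#) → (x * (x ⁻¹)) ≈ 1#
    charZero : ∀ n → ¬ (ι (suc n) ≈ 0#)

-- Evaluations of the polynomials of the paper at a point of 𝕂^ℕ
-- (x i is the value of the variable X_i).
module Ops {c ℓ : Level} (F : CharZeroField c ℓ) where
  open CharZeroField F

  pow : Carrier → ℕ → Carrier
  pow x zero    = 1#
  pow x (suc n) = x * pow x n

  ipow : Carrier → ℤ → Carrier
  ipow x (+ n)     = pow x n
  ipow x -[1+ n ]  = pow (x ⁻¹) (suc n)

  ιℤ : ℤ → Carrier
  ιℤ (+ n)    = ι n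
  ιℤ -[1+ n ] = - ι (suc n)

  fall : ℤ → ℕ → Carrier
  fall r zero    = 1#
  fall r (suc j) = fall r j * ιℤ (r ℤ.- + j)

  sumL : List Carrier → Carrier
  sumL = List.foldr _+_ 0#

  box : (l b : ℕ) → List (Vec ℕ l)
  box zero    b = [ [] ]
  box (suc l) b = concatMap (λ r → List.map (r ∷_) (box l b)) (upTo (suc b))

  -- pair the entries r_i with their index i (indices start at 1)
  indexed : ∀ {n} → Vec ℕ n → Vec (ℕ × ℕ) n
  indexed v = Vec.zip (Vec.tabulate (λ (f : Fin _) → suc (toℕ f))) v

  wsum : ∀ {n} → Vec ℕ n → ℕ
  wsum v = Vec.foldr _ (λ p acc → proj₁ p ℕ.* proj₂ p ℕ.+ acc) 0 (indexed v)

  -- the tuples (r_1,…,r_n) of non-negative integers with Σ r_i = k, Σ i r_i = n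
  -- (each r_i ≤ n necessarily, so enumerating the box {0,…,n}^n is exhaustive)
  tuples : (n k : ℕ) → List (Vec ℕ n)
  tuples n k = filter (λ v → (Vec.sum v ≟ k) ×-dec (wsum v ≟ n)) (box n n)

  denom : ∀ {n} → Vec ℕ n → ℕ
  denom v = Vec.foldr _ (λ p acc → ((proj₂ p) !) ℕ.* (((proj₁ p) !) ℕ.^ (proj₂ p)) ℕ.* acc) 1 (indexed v)

  mono : ∀ {n} → (ℕ → Carrier) → Vec ℕ n → Carrier
  mono x v = Vec.foldr _ (λ p acc → pow (x (proj₁ p)) (proj₂ p) * acc) 1# (indexed v)

  B : ℕ → ℕ → (ℕ → Carrier) → Carrier
  B zero    zero    x = 1#
  B (suc n) zero    x = 0#
  B n       (suc k) x with n ℕ.<? suc k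
  ... | Relation.Nullary.yes _ = 0#
  ... | Relation.Nullary.no  _ =
    sumL (List.map (λ v → (ι (n !) * (ι (denom v) ⁻¹)) * mono x v) (tuples n (suc k)))

  Phat : ℕ → ℤ → (ℕ → Carrier) → Carrier
  Phat m r x = sumL (List.map (λ j → fall r j * ipow (x 0) (r ℤ.- + j) * B m j x) (upTo (suc m)))

-- B_{n,k}(x) / n! is the sum, over the partitions of n into k parts, of ∏ᵢ (xᵢ / i!)^{rᵢ} / rᵢ!,
-- rᵢ being the multiplicity of the part i.  Sort these partitions by the number k − j of parts
-- equal to 1, and subtract 1 from each of the j remaining parts: this is a bijection onto the
-- partitions of n − k into j parts, and it turns x_{i+1} / (i+1)! into yᵢ / i! with
-- yᵢ = x_{i+1} / (i+1).  Hence B_{n,k}(x) / n! = Σⱼ y₀^{k−j} / (k−j)! · B_{n−k,j}(y) / (n−k)!,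
-- which is the claim because n! = C(n,k) k! (n−k)! and k! / (k−j)! = k (k−1) ⋯ (k−j+1); the
-- terms with j > k or j > n − k vanish on both sides.
module Submission where

open import Defs
open import Level using (Level)
open import Data.Nat using (ℕ; suc; _≤_; _∸_)
open import Data.Nat.Combinatorics using (_C_)
open import Data.Integer using (+_)

open import Data.Nat as ℕ using (zero; _<_; z≤n; s≤s; s≤s⁻¹; NonZero; _!; _≤?_; _<?_; _≟_)
import Data.Nat.Properties as ℕₚ
import Data.Nat.Combinatorics as Combinatorics
import Data.Nat.Combinatorics.Specification as CombinatoricsSpec
import Data.Nat.DivMod as DivMod
import Data.Integer as ℤ
import Data.Integer.Properties as ℤₚ
import Data.List.Properties as Listₚ
open import Data.Fin using (Fin; toℕ) renaming (zero to fzero; suc to fsuc)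
open import Data.Vec as Vec using (Vec; []; _∷_)
open import Data.List as List using (List)
open import Data.Product using (_×_; _,_; proj₁; proj₂)
open import Data.Sum using (_⊎_; inj₁; inj₂)
open import Relation.Nullary using (¬_; Dec; yes; no)
open import Relation.Nullary.Decidable using (_×-dec_)
open import Relation.Nullary.Negation using (contradiction)
open import Relation.Binary.PropositionalEquality as ≡ using (_≡_; cong; cong₂)
open import Function using (_∘_)
import Algebra.Solver.CommutativeMonoid as CommutativeMonoidSolver
import Algebra.Properties.CommutativeSemigroup as CommutativeSemigroupProperties
import Algebra.Properties.Semiring.Mult as SemiringMult
import Algebra.Properties.CommutativeSemiring.Exp as CommutativeSemiringExp
import Relation.Binary.Reasoning.Setoid as SetoidReasoning

module NatArithmetic where
  open import Data.Nat using (_+_; _*_)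
  open ℕₚ
  open ≡.≡-Reasoning

  n!≡nCk*[k!*[n∸k]!] : ∀ {n k} → k ≤ n → n ! ≡ (n C k) * (k ! * (n ∸ k) !)
  n!≡nCk*[k!*[n∸k]!] {n} {k} k≤n = ≡.sym (begin
    (n C k) * (k ! * (n ∸ k) !)
      ≡⟨ cong (_* (k ! * (n ∸ k) !)) (CombinatoricsSpec.nCk≡n!/k![n-k]! k≤n) ⟩
    (n ! / (k ! * (n ∸ k) !)) {{k !* (n ∸ k) !≢0}} * (k ! * (n ∸ k) !)
      ≡⟨ DivMod.m/n*n≡m {{k !* (n ∸ k) !≢0}} (Combinatorics.k![n∸k]!∣n! k≤n) ⟩
    n ! ∎)
    where open DivMod using (_/_)

  [m+n]∸[o+p]≡[m∸p]+[n∸o] : ∀ {m n o p} → o ≤ n → p ≤ m → (m + n) ∸ (o + p) ≡ (m ∸ p) + (n ∸ o)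
  [m+n]∸[o+p]≡[m∸p]+[n∸o] {m} {n} {o} {p} o≤n p≤m = begin
    (m + n) ∸ (o + p)  ≡⟨ cong ((m + n) ∸_) (+-comm o p) ⟩
    (m + n) ∸ (p + o)  ≡⟨ ∸-+-assoc (m + n) p o ⟨
    (m + n) ∸ p ∸ o    ≡⟨ cong (_∸ o) (+-∸-comm n p≤m) ⟩
    (m ∸ p + n) ∸ o    ≡⟨ +-∸-assoc (m ∸ p) o≤n ⟩
    (m ∸ p) + (n ∸ o)  ∎

  [m+n]∸[o+p]<n∸o : ∀ {m n o p} → o + p ≤ m + n → m < p → (m + n) ∸ (o + p) < n ∸ o
  [m+n]∸[o+p]<n∸o {m} {n} {o} {p} o+p≤m+n m<p =
    ≡.subst (_< n ∸ o) (≡.trans (∸-+-assoc (m + n) p o) (cong ((m + n) ∸_) (+-comm p o)))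
      (∸-monoˡ-< [m+n]∸p<n (m+n≤o⇒m≤o∸n o o+p≤m+n))
    where
    [m+n]∸p<n : (m + n) ∸ p < n
    [m+n]∸p<n = ≡.subst ((m + n) ∸ p <_) (m+n∸m≡n p n)
                  (∸-monoˡ-< (+-monoˡ-< n m<p) (m+n≤o⇒n≤o o o+p≤m+n))

  m∸o*p<o*[n∸p] : ∀ {m n o p} → m < o * n → o * p ≤ m → m ∸ o * p < o * (n ∸ p)
  m∸o*p<o*[n∸p] {m} {n} {o} {p} m<o*n o*p≤m =
    ≡.subst (m ∸ o * p <_) (≡.sym (*-distribˡ-∸ o n p)) (∸-monoˡ-< m<o*n o*p≤m)

  m∸[n∸o]≡[m∸n]+o : ∀ {m n o} → o ≤ n → n ≤ m → m ∸ (n ∸ o) ≡ (m ∸ n) + o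
  m∸[n∸o]≡[m∸n]+o {m} {n} {o} o≤n n≤m = begin
    m ∸ (n ∸ o)              ≡⟨ cong (_∸ (n ∸ o)) (m∸n+n≡m n≤m) ⟨
    (m ∸ n + n) ∸ (n ∸ o)    ≡⟨ +-∸-assoc (m ∸ n) (m∸n≤m n o) ⟩
    (m ∸ n) + (n ∸ (n ∸ o))  ≡⟨ cong (λ t → (m ∸ n) + t) (m∸[m∸n]≡n o≤n) ⟩
    (m ∸ n) + o              ∎

  +m-+n≡+[m∸n] : ∀ {m n} → n ≤ m → + m ℤ.- + n ≡ + (m ∸ n)
  +m-+n≡+[m∸n] {m} {n} n≤m = ≡.trans (ℤₚ.m-n≡m⊖n m n) (ℤₚ.⊖-≥ n≤m)

open NatArithmetic

foldrFrom : ∀ {a} {A : Set a} {l} → (ℕ → ℕ → A → A) → A → ℕ → Vec ℕ l → A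
foldrFrom f e i []      = e
foldrFrom f e i (r ∷ v) = f i r (foldrFrom f e (suc i) v)

foldr-zip-tabulate : ∀ {a} {A : Set a} (f : ℕ → ℕ → A → A) e {l} (h : Fin l → ℕ) i (v : Vec ℕ l) →
  (∀ j → h j ≡ i ℕ.+ toℕ j) →
  Vec.foldr (λ _ → A) (λ p acc → f (proj₁ p) (proj₂ p) acc) e (Vec.zip (Vec.tabulate h) v) ≡ foldrFrom f e i v
foldr-zip-tabulate f e h i []      h≡i+ = ≡.refl
foldr-zip-tabulate f e h i (r ∷ v) h≡i+ =
  cong₂ (λ j acc → f j r acc) (≡.trans (h≡i+ fzero) (ℕₚ.+-identityʳ i))
    (foldr-zip-tabulate f e (h ∘ fsuc) (suc i) v (λ j → ≡.trans (h≡i+ (fsuc j)) (ℕₚ.+-suc i (toℕ j))))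

module FieldArithmetic {c ℓ} (F : CharZeroField c ℓ) where
  open CharZeroField F
  open Ops F
  open SetoidReasoning setoid
  open CommutativeSemigroupProperties *-commutativeSemigroup using (interchange)
  private
    module Mult = SemiringMult semiring
    module Exp = CommutativeSemiringExp commutativeSemiring

  ι≡×1# : ∀ n → ι n ≡ n Mult.× 1#
  ι≡×1# zero    = ≡.refl
  ι≡×1# (suc n) = cong (λ t → 1# + t) (ι≡×1# n)

  ι-* : ∀ m n → ι (m ℕ.* n) ≈ ι m * ι n
  ι-* m n = begin
    ι (m ℕ.* n)                    ≡⟨ ι≡×1# (m ℕ.* n) ⟩
    (m ℕ.* n) Mult.× 1#            ≈⟨ Mult.×1-homo-* m n ⟩
    (m Mult.× 1#) * (n Mult.× 1#)  ≡⟨ cong₂ _*_ (ι≡×1# m) (ι≡×1# n) ⟨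
    ι m * ι n                      ∎

  pow≡^ : ∀ x n → pow x n ≡ x Exp.^ n
  pow≡^ x zero    = ≡.refl
  pow≡^ x (suc n) = cong (x *_) (pow≡^ x n)

  pow-cong : ∀ {x y} n → x ≈ y → pow x n ≈ pow y n
  pow-cong {x} {y} n x≈y = begin
    pow x n    ≡⟨ pow≡^ x n ⟩
    x Exp.^ n  ≈⟨ Exp.^-congˡ n x≈y ⟩
    y Exp.^ n  ≡⟨ pow≡^ y n ⟨
    pow y n    ∎

  pow-distrib-* : ∀ x y n → pow (x * y) n ≈ pow x n * pow y n
  pow-distrib-* x y n = begin
    pow (x * y) n              ≡⟨ pow≡^ (x * y) n ⟩
    (x * y) Exp.^ n            ≈⟨ Exp.^-distrib-* x y n ⟩
    x Exp.^ n * y Exp.^ n      ≡⟨ cong₂ _*_ (pow≡^ x n) (pow≡^ y n) ⟨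
    pow x n * pow y n          ∎

  ι≉0 : ∀ n .{{_ : NonZero n}} → ¬ ι n ≈ 0#
  ι≉0 (suc n) = charZero n

  ⁻¹-unique : ∀ {x y} → ¬ x ≈ 0# → x * y ≈ 1# → y ≈ x ⁻¹
  ⁻¹-unique {x} {y} x≉0 x*y≈1 = begin
    y                ≈⟨ *-identityʳ y ⟨
    y * 1#           ≈⟨ *-congˡ (inverse x x≉0) ⟨
    y * (x * x ⁻¹)   ≈⟨ *-assoc y x (x ⁻¹) ⟨
    (y * x) * x ⁻¹   ≈⟨ *-congʳ (trans (*-comm y x) x*y≈1) ⟩
    1# * x ⁻¹        ≈⟨ *-identityˡ (x ⁻¹) ⟩
    x ⁻¹             ∎

  ι1⁻¹≈1 : ι 1 ⁻¹ ≈ 1#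
  ι1⁻¹≈1 = sym (⁻¹-unique (ι≉0 1) (trans (*-identityʳ (ι 1)) (+-identityʳ 1#)))

  ι-*-⁻¹ : ∀ m n .{{_ : NonZero m}} .{{_ : NonZero n}} → ι (m ℕ.* n) ⁻¹ ≈ ι m ⁻¹ * ι n ⁻¹
  ι-*-⁻¹ m n = sym (⁻¹-unique (ι≉0 (m ℕ.* n) {{ℕₚ.m*n≢0 m n}}) (begin
    ι (m ℕ.* n) * (ι m ⁻¹ * ι n ⁻¹)      ≈⟨ *-congʳ (ι-* m n) ⟩
    (ι m * ι n) * (ι m ⁻¹ * ι n ⁻¹)      ≈⟨ interchange (ι m) (ι n) (ι m ⁻¹) (ι n ⁻¹) ⟩
    (ι m * ι m ⁻¹) * (ι n * ι n ⁻¹)      ≈⟨ *-cong (inverse (ι m) (ι≉0 m)) (inverse (ι n) (ι≉0 n)) ⟩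
    1# * 1#                              ≈⟨ *-identityˡ 1# ⟩
    1#                                   ∎))

  ι-^-⁻¹ : ∀ m r .{{_ : NonZero m}} → ι (m ℕ.^ r) ⁻¹ ≈ pow (ι m ⁻¹) r
  ι-^-⁻¹ m zero    = ι1⁻¹≈1
  ι-^-⁻¹ m (suc r) {{m≢0}} = trans (ι-*-⁻¹ m (m ℕ.^ r) {{m≢0}} {{ℕₚ.m^n≢0 m r}}) (*-congˡ (ι-^-⁻¹ m r))

  ≈ι*ι⁻¹ : ∀ {x} m n .{{_ : NonZero n}} → x * ι n ≈ ι m → x ≈ ι m * ι n ⁻¹
  ≈ι*ι⁻¹ {x} m n x*n≈m = begin
    x                     ≈⟨ *-identityʳ x ⟨
    x * 1#                ≈⟨ *-congˡ (inverse (ι n) (ι≉0 n)) ⟨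
    x * (ι n * ι n ⁻¹)    ≈⟨ *-assoc x (ι n) (ι n ⁻¹) ⟨
    (x * ι n) * ι n ⁻¹    ≈⟨ *-congʳ x*n≈m ⟩
    ι m * ι n ⁻¹          ∎

module Sums {c ℓ} (F : CharZeroField c ℓ) where
  open CharZeroField F
  open Ops F
  open SetoidReasoning setoid

  guard : ∀ {p} {P : Set p} → Dec P → Carrier → Carrier
  guard (yes _) t = t
  guard (no _)  _ = 0#

  module _ {p} {P : Set p} where

    guard-yes : ∀ (P? : Dec P) {t} → P → guard P? t ≡ t
    guard-yes (yes _) _ = ≡.refl
    guard-yes (no ¬p) p = contradiction p ¬p

    guard-no : ∀ (P? : Dec P) {t} → ¬ P → guard P? t ≡ 0#
    guard-no (yes p) ¬p = contradiction p ¬p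
    guard-no (no _)  _  = ≡.refl

    guard-≈0 : ∀ (P? : Dec P) {t} → (P → t ≈ 0#) → guard P? t ≈ 0#
    guard-≈0 (yes p) t≈0 = t≈0 p
    guard-≈0 (no _)  _   = refl

    guard-cong : ∀ (P? : Dec P) {t u} → t ≈ u → guard P? t ≈ guard P? u
    guard-cong (yes _) t≈u = t≈u
    guard-cong (no _)  _   = refl

    guard-*ˡ : ∀ (P? : Dec P) x {t} → guard P? (x * t) ≈ x * guard P? t
    guard-*ˡ (yes _) x = refl
    guard-*ˡ (no _)  x = sym (zeroʳ x)

  guard-⇔ : ∀ {p q} {P : Set p} {Q : Set q} (P? : Dec P) (Q? : Dec Q) {t} →
            (P → Q) → (Q → P) → guard P? t ≡ guard Q? t
  guard-⇔ (yes _) (yes _) _   _   = ≡.refl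
  guard-⇔ (yes p) (no ¬q) p⇒q _   = contradiction (p⇒q p) ¬q
  guard-⇔ (no ¬p) (yes q) _   q⇒p = contradiction (q⇒p q) ¬p
  guard-⇔ (no _)  (no _)  _   _   = ≡.refl

  sumTo : ℕ → (ℕ → Carrier) → Carrier
  sumTo m g = sumL (List.applyUpTo g m)

  sumL-map-upTo : ∀ (g : ℕ → Carrier) m → sumL (List.map g (List.upTo m)) ≡ sumTo m g
  sumL-map-upTo g m = cong sumL (Listₚ.map-upTo g m)

  sumTo-cong : ∀ m {g h : ℕ → Carrier} → (∀ i → i < m → g i ≈ h i) → sumTo m g ≈ sumTo m h
  sumTo-cong zero    g≈h = refl
  sumTo-cong (suc m) g≈h = +-cong (g≈h 0 (s≤s z≤n)) (sumTo-cong m (λ i i<m → g≈h (suc i) (s≤s i<m)))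

  sumTo-≈0 : ∀ m {g : ℕ → Carrier} → (∀ i → g i ≈ 0#) → sumTo m g ≈ 0#
  sumTo-≈0 zero    g≈0 = refl
  sumTo-≈0 (suc m) g≈0 = trans (+-cong (g≈0 0) (sumTo-≈0 m (g≈0 ∘ suc))) (+-identityˡ 0#)

  sumTo-*ˡ : ∀ m x (g : ℕ → Carrier) → sumTo m (λ i → x * g i) ≈ x * sumTo m g
  sumTo-*ˡ zero    x g = sym (zeroʳ x)
  sumTo-*ˡ (suc m) x g = trans (+-congˡ (sumTo-*ˡ m x (g ∘ suc))) (sym (distribˡ x _ _))

  sumTo-extend : ∀ {a b} {g : ℕ → Carrier} → a ≤ b → (∀ i → a < i → g i ≈ 0#) →
                 sumTo (suc b) g ≈ sumTo (suc a) g
  sumTo-extend {zero}  {b}     _ g≈0 = +-congˡ (sumTo-≈0 b (λ i → g≈0 (suc i) (s≤s z≤n)))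
  sumTo-extend {suc a} {suc b} (s≤s a≤b) g≈0 =
    +-congˡ (sumTo-extend a≤b (λ i a<i → g≈0 (suc i) (s≤s a<i)))

  sumTo-vanishing : ∀ {a b} {g : ℕ → Carrier} → (∀ i → a < i → g i ≈ 0#) → (∀ i → b < i → g i ≈ 0#) →
                    sumTo (suc a) g ≈ sumTo (suc b) g
  sumTo-vanishing {a} {b} g≈0-beyond-a g≈0-beyond-b with ℕₚ.≤-total a b
  ... | inj₁ a≤b = sym (sumTo-extend a≤b g≈0-beyond-a)
  ... | inj₂ b≤a = sumTo-extend b≤a g≈0-beyond-b

  sumTo-snoc : ∀ m (g : ℕ → Carrier) → sumTo (suc m) g ≈ sumTo m g + g m
  sumTo-snoc zero    g = +-comm (g 0) 0#
  sumTo-snoc (suc m) g = trans (+-congˡ (sumTo-snoc m (g ∘ suc))) (sym (+-assoc _ _ _))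

  sumTo-reverse : ∀ k (g : ℕ → Carrier) → sumTo (suc k) g ≈ sumTo (suc k) (λ j → g (k ∸ j))
  sumTo-reverse zero    g = refl
  sumTo-reverse (suc k) g = begin
    g 0 + sumTo (suc k) (g ∘ suc)                                 ≈⟨ +-congˡ (sumTo-reverse k (g ∘ suc)) ⟩
    g 0 + sumTo (suc k) (λ j → g (suc (k ∸ j)))                   ≈⟨ +-comm _ _ ⟩
    sumTo (suc k) (λ j → g (suc (k ∸ j))) + g 0                   ≈⟨ +-cong (sumTo-cong (suc k) reindex) last ⟩
    sumTo (suc k) (λ j → g (suc k ∸ j)) + g (suc k ∸ suc k)       ≈⟨ sumTo-snoc (suc k) (λ j → g (suc k ∸ j)) ⟨
    sumTo (suc (suc k)) (λ j → g (suc k ∸ j))                     ∎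
    where
    reindex : ∀ j → j < suc k → g (suc (k ∸ j)) ≈ g (suc k ∸ j)
    reindex j j<1+k = reflexive (cong g (≡.sym (ℕₚ.+-∸-assoc 1 (s≤s⁻¹ j<1+k))))
    last : g 0 ≈ g (suc k ∸ suc k)
    last = reflexive (cong g (≡.sym (ℕₚ.n∸n≡0 k)))

  sumL-map-cong : ∀ {a} {A : Set a} {f g : A → Carrier} (xs : List A) → (∀ x → f x ≈ g x) →
                  sumL (List.map f xs) ≈ sumL (List.map g xs)
  sumL-map-cong List.[]       f≈g = refl
  sumL-map-cong (x List.∷ xs) f≈g = +-cong (f≈g x) (sumL-map-cong xs f≈g)

  sumL-map-≈0 : ∀ {a} {A : Set a} {f : A → Carrier} (xs : List A) → (∀ x → f x ≈ 0#) →
                sumL (List.map f xs) ≈ 0#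
  sumL-map-≈0 List.[]       f≈0 = refl
  sumL-map-≈0 (x List.∷ xs) f≈0 = trans (+-cong (f≈0 x) (sumL-map-≈0 xs f≈0)) (+-identityˡ 0#)

  sumL-map-*ˡ : ∀ {a} {A : Set a} x (f : A → Carrier) (xs : List A) →
                sumL (List.map (λ y → x * f y) xs) ≈ x * sumL (List.map f xs)
  sumL-map-*ˡ x f List.[]       = sym (zeroʳ x)
  sumL-map-*ˡ x f (y List.∷ ys) = trans (+-congˡ (sumL-map-*ˡ x f ys)) (sym (distribˡ x _ _))

  sumL-++ : ∀ xs ys → sumL (xs List.++ ys) ≈ sumL xs + sumL ys
  sumL-++ List.[]       ys = sym (+-identityˡ _)
  sumL-++ (x List.∷ xs) ys = trans (+-congˡ (sumL-++ xs ys)) (sym (+-assoc _ _ _))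

  sumL-map-concatMap : ∀ {a b} {A : Set a} {B : Set b} (g : B → Carrier) (h : A → List B) xs →
    sumL (List.map g (List.concatMap h xs)) ≈ sumL (List.map (λ x → sumL (List.map g (h x))) xs)
  sumL-map-concatMap g h List.[]       = refl
  sumL-map-concatMap g h (x List.∷ xs) = begin
    sumL (List.map g (h x List.++ List.concatMap h xs))
      ≡⟨ cong sumL (Listₚ.map-++ g (h x) _) ⟩
    sumL (List.map g (h x) List.++ List.map g (List.concatMap h xs))
      ≈⟨ sumL-++ (List.map g (h x)) _ ⟩
    sumL (List.map g (h x)) + sumL (List.map g (List.concatMap h xs))
      ≈⟨ +-congˡ (sumL-map-concatMap g h xs) ⟩
    sumL (List.map g (h x)) + sumL (List.map (λ y → sumL (List.map g (h y))) xs) ∎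

  sumL-map-filter : ∀ {a p} {A : Set a} {P : A → Set p} (P? : ∀ x → Dec (P x)) (f : A → Carrier) xs →
    sumL (List.map f (List.filter P? xs)) ≈ sumL (List.map (λ x → guard (P? x) (f x)) xs)
  sumL-map-filter P? f List.[] = refl
  sumL-map-filter P? f (x List.∷ xs) with P? x
  ... | yes _ = +-congˡ (sumL-map-filter P? f xs)
  ... | no _  = trans (sumL-map-filter P? f xs) (sym (+-identityˡ _))

module PartitionSums {c ℓ} (F : CharZeroField c ℓ) where
  open CharZeroField F
  open Ops F
  open Sums F
  open SetoidReasoning setoid

  Weight : Set c
  Weight = ℕ → ℕ → Carrier

  -- partSum w a l K N is the sum, over the partitions of N into exactly K parts of sizes in
  -- {a, …, a + l - 1}, of ∏ᵢ w i rᵢ where rᵢ is the multiplicity of the part i; the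
  -- recursion chooses the multiplicity r of the part a.
  partSum : Weight → (a l K N : ℕ) → Carrier
  partSum w a zero    K N = guard ((0 ≟ K) ×-dec (0 ≟ N)) 1#
  partSum w a (suc l) K N =
    sumTo (suc K) λ r → guard (a ℕ.* r ≤? N) (w a r * partSum w (suc a) l (K ∸ r) (N ∸ a ℕ.* r))

  N<a*K⇒partSum≈0 : ∀ w a l {K N} → N < a ℕ.* K → partSum w a l K N ≈ 0#
  N<a*K⇒partSum≈0 w a zero {K} {N} N<a*K = reflexive (guard-no ((0 ≟ K) ×-dec (0 ≟ N)) notEmpty)
    where
    notEmpty : ¬ (0 ≡ K × 0 ≡ N)
    notEmpty (≡.refl , ≡.refl) = ℕₚ.<-irrefl ≡.refl (≡.subst (0 <_) (ℕₚ.*-zeroʳ a) N<a*K)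
  N<a*K⇒partSum≈0 w a (suc l) {K} {N} N<a*K = sumTo-≈0 (suc K) λ r →
    guard-≈0 (a ℕ.* r ≤? N) λ a*r≤N → trans (*-congˡ (N<a*K⇒partSum≈0 w (suc a) l
      (ℕₚ.<-≤-trans (m∸o*p<o*[n∸p] {N} {K} {a} {r} N<a*K a*r≤N) (ℕₚ.m≤n+m (a ℕ.* (K ∸ r)) (K ∸ r))))) (zeroʳ (w a r))

  partSum-noParts : ∀ w a l N → partSum w a l 0 (suc N) ≈ 0#
  partSum-noParts w a zero    N = refl
  partSum-noParts w a (suc l) N = trans (+-identityʳ _) (guard-≈0 (a ℕ.* 0 ≤? suc N) λ _ →
    trans (*-congˡ (trans (reflexive (cong (partSum w (suc a) l 0 ∘ (suc N ∸_)) (ℕₚ.*-zeroʳ a)))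
                          (partSum-noParts w (suc a) l N)))
          (zeroʳ (w a 0)))

  N<a⇒partSum≈empty : ∀ w a l {K N} → (∀ i → w i 0 ≈ 1#) → N < a → partSum w a l K N ≈ partSum w a 0 K N
  N<a⇒partSum≈empty w a zero    w·0≈1 N<a = refl
  N<a⇒partSum≈empty w a (suc l) {K} {N} w·0≈1 N<a =
    trans (+-cong multiplicity0 (sumTo-≈0 K λ r → reflexive (guard-no (a ℕ.* suc r ≤? N) (tooLarge r))))
          (+-identityʳ _)
    where
    tooLarge : ∀ r → ¬ a ℕ.* suc r ≤ N
    tooLarge r a*[1+r]≤N = ℕₚ.<⇒≱ N<a (ℕₚ.≤-trans (ℕₚ.m≤m*n a (suc r)) a*[1+r]≤N)
    multiplicity0 : guard (a ℕ.* 0 ≤? N) (w a 0 * partSum w (suc a) l K (N ∸ a ℕ.* 0)) ≈ partSum w a 0 K N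
    multiplicity0 = begin
      guard (a ℕ.* 0 ≤? N) (w a 0 * partSum w (suc a) l K (N ∸ a ℕ.* 0))
        ≡⟨ guard-yes (a ℕ.* 0 ≤? N) (≡.subst (ℕ._≤ N) (≡.sym (ℕₚ.*-zeroʳ a)) z≤n) ⟩
      w a 0 * partSum w (suc a) l K (N ∸ a ℕ.* 0)
        ≈⟨ *-cong (w·0≈1 a) (reflexive (cong (partSum w (suc a) l K ∘ (N ∸_)) (ℕₚ.*-zeroʳ a))) ⟩
      1# * partSum w (suc a) l K N
        ≈⟨ *-identityˡ _ ⟩
      partSum w (suc a) l K N
        ≈⟨ N<a⇒partSum≈empty w (suc a) l w·0≈1 (ℕₚ.m<n⇒m<1+n N<a) ⟩
      partSum w a 0 K N ∎

  partSum-unusedSizes : ∀ w a l e {K N} → (∀ i → w i 0 ≈ 1#) → N < a ℕ.+ l →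
                        partSum w a (l ℕ.+ e) K N ≈ partSum w a l K N
  partSum-unusedSizes w a zero    e w·0≈1 N<a+0 =
    N<a⇒partSum≈empty w a e w·0≈1 (≡.subst (_ <_) (ℕₚ.+-identityʳ a) N<a+0)
  partSum-unusedSizes w a (suc l) e {K} {N} w·0≈1 N<a+1+l = sumTo-cong (suc K) λ r _ →
    guard-cong (a ℕ.* r ≤? N) (*-congˡ {w a r} (partSum-unusedSizes w (suc a) l e {K ∸ r} w·0≈1
      (ℕₚ.≤-<-trans (ℕₚ.m∸n≤m N (a ℕ.* r)) (≡.subst (N <_) (ℕₚ.+-suc a l) N<a+1+l))))

  partSum-shift : ∀ {w w′ : Weight} → (∀ i r → w (suc i) r ≈ w′ i r) →
                  ∀ a l K N → partSum w (suc a) l K (N ℕ.+ K) ≈ partSum w′ a l K N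
  partSum-shift w≈w′ a zero zero    zero    = refl
  partSum-shift w≈w′ a zero zero    (suc N) = refl
  partSum-shift w≈w′ a zero (suc K) N       = refl
  partSum-shift {w} {w′} w≈w′ a (suc l) K N = sumTo-cong (suc K) λ r r<1+K → shiftTerm r (s≤s⁻¹ r<1+K)
    where
    shiftTerm : ∀ r → r ≤ K →
      guard (suc a ℕ.* r ≤? N ℕ.+ K) (w (suc a) r * partSum w (suc (suc a)) l (K ∸ r) ((N ℕ.+ K) ∸ suc a ℕ.* r))
        ≈ guard (a ℕ.* r ≤? N) (w′ a r * partSum w′ (suc a) l (K ∸ r) (N ∸ a ℕ.* r))
    shiftTerm r r≤K with a ℕ.* r ≤? N
    ... | yes a*r≤N = begin
      guard (suc a ℕ.* r ≤? N ℕ.+ K) (w (suc a) r * partSum w (suc (suc a)) l (K ∸ r) ((N ℕ.+ K) ∸ suc a ℕ.* r))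
        ≡⟨ guard-yes (suc a ℕ.* r ≤? N ℕ.+ K) (≡.subst (r ℕ.+ a ℕ.* r ≤_) (ℕₚ.+-comm K N) (ℕₚ.+-mono-≤ r≤K a*r≤N)) ⟩
      w (suc a) r * partSum w (suc (suc a)) l (K ∸ r) ((N ℕ.+ K) ∸ (r ℕ.+ a ℕ.* r))
        ≈⟨ *-cong (w≈w′ a r) (reflexive (cong (partSum w (suc (suc a)) l (K ∸ r)) ([m+n]∸[o+p]≡[m∸p]+[n∸o] r≤K a*r≤N))) ⟩
      w′ a r * partSum w (suc (suc a)) l (K ∸ r) ((N ∸ a ℕ.* r) ℕ.+ (K ∸ r))
        ≈⟨ *-congˡ (partSum-shift w≈w′ (suc a) l (K ∸ r) (N ∸ a ℕ.* r)) ⟩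
      w′ a r * partSum w′ (suc a) l (K ∸ r) (N ∸ a ℕ.* r) ∎
    ... | no a*r≰N = guard-≈0 (suc a ℕ.* r ≤? N ℕ.+ K) λ r+a*r≤N+K →
      trans (*-congˡ (N<a*K⇒partSum≈0 w (suc (suc a)) l
              (ℕₚ.<-≤-trans ([m+n]∸[o+p]<n∸o {N} {K} {r} {a ℕ.* r} r+a*r≤N+K (ℕₚ.≰⇒> a*r≰N)) (ℕₚ.m≤m+n (K ∸ r) _))))
            (zeroʳ (w (suc a) r))

  weightedSum : ∀ {l} → ℕ → Vec ℕ l → ℕ
  weightedSum = foldrFrom (λ i r s → i ℕ.* r ℕ.+ s) 0

  prodWeight : ∀ {l} → Weight → ℕ → Vec ℕ l → Carrier
  prodWeight w = foldrFrom (λ i r p → w i r * p) 1#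

  -- v lists the multiplicities of the part sizes a, a + 1, … in a partition of N into K parts.
  IsPartition : ∀ {l} → (K N a : ℕ) → Vec ℕ l → Set
  IsPartition K N a v = Vec.sum v ≡ K × weightedSum a v ≡ N

  isPartition? : ∀ {l} K N a (v : Vec ℕ l) → Dec (IsPartition K N a v)
  isPartition? K N a v = (Vec.sum v ≟ K) ×-dec (weightedSum a v ≟ N)

  module _ (K N a r : ℕ) {l} (v : Vec ℕ l) where

    isPartition-∷⁻ : IsPartition K N a (r ∷ v) → r ≤ K × a ℕ.* r ≤ N
    isPartition-∷⁻ (Σ≡K , ws≡N) = ≡.subst (r ≤_) Σ≡K (ℕₚ.m≤m+n r _) , ≡.subst (a ℕ.* r ≤_) ws≡N (ℕₚ.m≤m+n (a ℕ.* r) _)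

    isPartition-tail : IsPartition K N a (r ∷ v) → IsPartition (K ∸ r) (N ∸ a ℕ.* r) (suc a) v
    isPartition-tail (Σ≡K , ws≡N) = ≡.trans (≡.sym (ℕₚ.m+n∸m≡n r _)) (cong (_∸ r) Σ≡K)
                                  , ≡.trans (≡.sym (ℕₚ.m+n∸m≡n (a ℕ.* r) _)) (cong (_∸ a ℕ.* r) ws≡N)

    isPartition-∷ : r ≤ K → a ℕ.* r ≤ N → IsPartition (K ∸ r) (N ∸ a ℕ.* r) (suc a) v → IsPartition K N a (r ∷ v)
    isPartition-∷ r≤K a*r≤N (Σ≡K∸r , ws≡N∸a*r) = ≡.trans (cong (r ℕ.+_) Σ≡K∸r) (ℕₚ.m+[n∸m]≡n r≤K)
                                                , ≡.trans (cong (a ℕ.* r ℕ.+_) ws≡N∸a*r) (ℕₚ.m+[n∸m]≡n a*r≤N)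

  sumL-box-suc : ∀ l b (g : Vec ℕ (suc l) → Carrier) →
    sumL (List.map g (box (suc l) b)) ≈ sumTo (suc b) (λ r → sumL (List.map (g ∘ (r ∷_)) (box l b)))
  sumL-box-suc l b g = begin
    sumL (List.map g (List.concatMap (λ r → List.map (r ∷_) (box l b)) (List.upTo (suc b))))
      ≈⟨ sumL-map-concatMap g (λ r → List.map (r ∷_) (box l b)) (List.upTo (suc b)) ⟩
    sumL (List.map (λ r → sumL (List.map g (List.map (r ∷_) (box l b)))) (List.upTo (suc b)))
      ≡⟨ cong sumL (Listₚ.map-cong (λ r → cong sumL (≡.sym (Listₚ.map-∘ (box l b)))) (List.upTo (suc b))) ⟩
    sumL (List.map (λ r → sumL (List.map (g ∘ (r ∷_)) (box l b))) (List.upTo (suc b)))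
      ≡⟨ sumL-map-upTo (λ r → sumL (List.map (g ∘ (r ∷_)) (box l b))) (suc b) ⟩
    sumTo (suc b) (λ r → sumL (List.map (g ∘ (r ∷_)) (box l b))) ∎

  partSum-box : ∀ w a l {K N b} → K ≤ b →
    sumL (List.map (λ v → guard (isPartition? K N a v) (prodWeight w a v)) (box l b)) ≈ partSum w a l K N
  partSum-box w a zero    K≤b = +-identityʳ _
  partSum-box w a (suc l) {K} {N} {b} K≤b = begin
    sumL (List.map summand (box (suc l) b))
      ≈⟨ sumL-box-suc l b summand ⟩
    sumTo (suc b) (λ r → sumL (List.map (summand ∘ (r ∷_)) (box l b)))
      ≈⟨ sumTo-extend K≤b (λ r K<r → sumL-map-≈0 (box l b) λ v →
           reflexive (guard-no (isPartition? K N a (r ∷ v)) {prodWeight w a (r ∷ v)} (ℕₚ.<⇒≱ K<r ∘ proj₁ ∘ isPartition-∷⁻ K N a r v))) ⟩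
    sumTo (suc K) (λ r → sumL (List.map (summand ∘ (r ∷_)) (box l b)))
      ≈⟨ sumTo-cong (suc K) (λ r r<1+K → firstMultiplicity r (s≤s⁻¹ r<1+K)) ⟩
    partSum w a (suc l) K N ∎
    where
    summand : Vec ℕ (suc l) → Carrier
    summand v = guard (isPartition? K N a v) (prodWeight w a v)
    firstMultiplicity : ∀ r → r ≤ K → sumL (List.map (summand ∘ (r ∷_)) (box l b))
      ≈ guard (a ℕ.* r ≤? N) (w a r * partSum w (suc a) l (K ∸ r) (N ∸ a ℕ.* r))
    firstMultiplicity r r≤K with a ℕ.* r ≤? N
    ... | no a*r≰N = sumL-map-≈0 (box l b) λ v →
      reflexive (guard-no (isPartition? K N a (r ∷ v)) {prodWeight w a (r ∷ v)} (a*r≰N ∘ proj₂ ∘ isPartition-∷⁻ K N a r v))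
    ... | yes a*r≤N = begin
      sumL (List.map (summand ∘ (r ∷_)) (box l b))
        ≈⟨ sumL-map-cong (box l b) (λ v → trans
             (reflexive (guard-⇔ (isPartition? K N a (r ∷ v)) (isPartition? (K ∸ r) (N ∸ a ℕ.* r) (suc a) v)
                           (isPartition-tail K N a r v) (isPartition-∷ K N a r v r≤K a*r≤N)))
             (guard-*ˡ (isPartition? (K ∸ r) (N ∸ a ℕ.* r) (suc a) v) (w a r))) ⟩
      sumL (List.map (λ v → w a r * guard (isPartition? (K ∸ r) (N ∸ a ℕ.* r) (suc a) v) (prodWeight w (suc a) v)) (box l b))
        ≈⟨ sumL-map-*ˡ (w a r) _ (box l b) ⟩
      w a r * sumL (List.map (λ v → guard (isPartition? (K ∸ r) (N ∸ a ℕ.* r) (suc a) v) (prodWeight w (suc a) v)) (box l b))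
        ≈⟨ *-congˡ (partSum-box w (suc a) l (ℕₚ.≤-trans (ℕₚ.m∸n≤m K r) K≤b)) ⟩
      w a r * partSum w (suc a) l (K ∸ r) (N ∸ a ℕ.* r) ∎

module BellPolynomials {c ℓ} (F : CharZeroField c ℓ) where
  open CharZeroField F
  open Ops F
  open FieldArithmetic F
  open Sums F
  open PartitionSums F
  open SetoidReasoning setoid
  open CommutativeSemigroupProperties *-commutativeSemigroup using (interchange; xy∙z≈zy∙x)
  private
    module Solver = CommutativeMonoidSolver *-commutativeMonoid

  bellWeight : (ℕ → Carrier) → Weight
  bellWeight x i r = pow (x i * ι (i !) ⁻¹) r * ι (r !) ⁻¹

  shift : (ℕ → Carrier) → ℕ → Carrier
  shift x i = x (suc i) * ι (suc i) ⁻¹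

  bellWeight-zero : ∀ x i → bellWeight x i 0 ≈ 1#
  bellWeight-zero x i = trans (*-identityˡ _) ι1⁻¹≈1

  bellWeight-suc : ∀ x i r → bellWeight x (suc i) r ≈ bellWeight (shift x) i r
  bellWeight-suc x i r = *-congʳ (pow-cong r (begin
    x (suc i) * ι (suc i ℕ.* i !) ⁻¹         ≈⟨ *-congˡ (ι-*-⁻¹ (suc i) (i !) {{_}} {{ℕₚ._!≢0 i}}) ⟩
    x (suc i) * (ι (suc i) ⁻¹ * ι (i !) ⁻¹)  ≈⟨ *-assoc _ _ _ ⟨
    shift x i * ι (i !) ⁻¹                   ∎))

  ι[r!*i!^r]⁻¹*x^r≈bellWeight : ∀ x i r → ι (r ! ℕ.* (i !) ℕ.^ r) ⁻¹ * pow (x i) r ≈ bellWeight x i r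
  ι[r!*i!^r]⁻¹*x^r≈bellWeight x i r = begin
    ι (r ! ℕ.* (i !) ℕ.^ r) ⁻¹ * pow (x i) r
      ≈⟨ *-congʳ (ι-*-⁻¹ (r !) ((i !) ℕ.^ r) {{ℕₚ._!≢0 r}} {{ℕₚ.m^n≢0 (i !) r {{ℕₚ._!≢0 i}}}}) ⟩
    (ι (r !) ⁻¹ * ι ((i !) ℕ.^ r) ⁻¹) * pow (x i) r
      ≈⟨ *-congʳ (*-congˡ (ι-^-⁻¹ (i !) r {{ℕₚ._!≢0 i}})) ⟩
    (ι (r !) ⁻¹ * pow (ι (i !) ⁻¹) r) * pow (x i) r
      ≈⟨ xy∙z≈zy∙x (ι (r !) ⁻¹) (pow (ι (i !) ⁻¹) r) (pow (x i) r) ⟩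
    (pow (x i) r * pow (ι (i !) ⁻¹) r) * ι (r !) ⁻¹
      ≈⟨ *-congʳ (pow-distrib-* (x i) (ι (i !) ⁻¹) r) ⟨
    bellWeight x i r ∎

  denominator : ∀ {l} → ℕ → Vec ℕ l → ℕ
  denominator = foldrFrom (λ i r d → (r ! ℕ.* (i !) ℕ.^ r) ℕ.* d) 1

  monomial : ∀ {l} → (ℕ → Carrier) → ℕ → Vec ℕ l → Carrier
  monomial x = foldrFrom (λ i r p → pow (x i) r * p) 1#

  denominator≢0 : ∀ {l} i (v : Vec ℕ l) → NonZero (denominator i v)
  denominator≢0 i []      = _
  denominator≢0 i (r ∷ v) =
    ℕₚ.m*n≢0 _ _ {{ℕₚ.m*n≢0 (r !) _ {{ℕₚ._!≢0 r}} {{ℕₚ.m^n≢0 (i !) r {{ℕₚ._!≢0 i}}}}}} {{denominator≢0 (suc i) v}}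

  ι[denominator]⁻¹*monomial≈prodWeight : ∀ {l} x i (v : Vec ℕ l) →
    ι (denominator i v) ⁻¹ * monomial x i v ≈ prodWeight (bellWeight x) i v
  ι[denominator]⁻¹*monomial≈prodWeight x i []      = trans (*-identityʳ _) ι1⁻¹≈1
  ι[denominator]⁻¹*monomial≈prodWeight x i (r ∷ v) = begin
    ι (f ℕ.* d) ⁻¹ * (pow (x i) r * monomial x (suc i) v)
      ≈⟨ *-congʳ (ι-*-⁻¹ f d {{ℕₚ.m*n≢0 (r !) _ {{ℕₚ._!≢0 r}} {{ℕₚ.m^n≢0 (i !) r {{ℕₚ._!≢0 i}}}}}} {{denominator≢0 (suc i) v}}) ⟩
    (ι f ⁻¹ * ι d ⁻¹) * (pow (x i) r * monomial x (suc i) v)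
      ≈⟨ interchange _ _ _ _ ⟩
    (ι f ⁻¹ * pow (x i) r) * (ι d ⁻¹ * monomial x (suc i) v)
      ≈⟨ *-cong (ι[r!*i!^r]⁻¹*x^r≈bellWeight x i r) (ι[denominator]⁻¹*monomial≈prodWeight x (suc i) v) ⟩
    bellWeight x i r * prodWeight (bellWeight x) (suc i) v ∎
    where
    f d : ℕ
    f = r ! ℕ.* (i !) ℕ.^ r
    d = denominator (suc i) v

  bell≈partSum : ∀ (y : ℕ → Carrier) m j → B m j y ≈ ι (m !) * partSum (bellWeight y) 1 m j m
  bell≈partSum y zero    zero    = sym (trans (*-identityʳ _) (+-identityʳ 1#))
  bell≈partSum y (suc m) zero    = sym (trans (*-congˡ (partSum-noParts (bellWeight y) 1 (suc m) m)) (zeroʳ _))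
  bell≈partSum y zero    (suc j) = sym (zeroʳ _)
  bell≈partSum y (suc m) (suc j) with suc m <? suc j
  ... | yes m<j = sym (trans (*-congˡ (N<a*K⇒partSum≈0 (bellWeight y) 1 (suc m)
                    (≡.subst (suc m <_) (≡.sym (ℕₚ.*-identityˡ (suc j))) m<j))) (zeroʳ _))
  ... | no m≮j = begin
    sumL (List.map T (List.filter tuple? (box n n)))
      ≈⟨ sumL-map-filter tuple? T (box n n) ⟩
    sumL (List.map (λ v → guard (tuple? v) (T v)) (box n n))
      ≈⟨ sumL-map-cong (box n n) summand ⟩
    sumL (List.map (λ v → ι (n !) * guard (isPartition? (suc j) n 1 v) (prodWeight w 1 v)) (box n n))
      ≈⟨ sumL-map-*ˡ (ι (n !)) _ (box n n) ⟩
    ι (n !) * sumL (List.map (λ v → guard (isPartition? (suc j) n 1 v) (prodWeight w 1 v)) (box n n))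
      ≈⟨ *-congˡ (partSum-box w 1 n (ℕₚ.≮⇒≥ m≮j)) ⟩
    ι (n !) * partSum w 1 n (suc j) n ∎
    where
    n : ℕ
    n = suc m
    w : Weight
    w = bellWeight y
    T : Vec ℕ n → Carrier
    T v = (ι (n !) * ι (denom v) ⁻¹) * mono y v
    tuple? : (v : Vec ℕ n) → Dec (Vec.sum v ≡ suc j × wsum v ≡ n)
    tuple? v = (Vec.sum v ≟ suc j) ×-dec (wsum v ≟ n)
    wsum≡weightedSum : ∀ v → wsum v ≡ weightedSum 1 v
    wsum≡weightedSum v = foldr-zip-tabulate (λ i r s → i ℕ.* r ℕ.+ s) 0 _ 1 v (λ _ → ≡.refl)
    T≈ : ∀ v → T v ≈ ι (n !) * prodWeight w 1 v
    T≈ v = begin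
      (ι (n !) * ι (denom v) ⁻¹) * mono y v
        ≈⟨ *-assoc _ _ _ ⟩
      ι (n !) * (ι (denom v) ⁻¹ * mono y v)
        ≡⟨ cong₂ (λ d p → ι (n !) * (ι d ⁻¹ * p))
             (foldr-zip-tabulate (λ i r d → (r ! ℕ.* (i !) ℕ.^ r) ℕ.* d) 1 _ 1 v (λ _ → ≡.refl))
             (foldr-zip-tabulate (λ i r p → pow (y i) r * p) 1# _ 1 v (λ _ → ≡.refl)) ⟩
      ι (n !) * (ι (denominator 1 v) ⁻¹ * monomial y 1 v)
        ≈⟨ *-congˡ (ι[denominator]⁻¹*monomial≈prodWeight y 1 v) ⟩
      ι (n !) * prodWeight w 1 v ∎
    summand : ∀ v → guard (tuple? v) (T v) ≈ ι (n !) * guard (isPartition? (suc j) n 1 v) (prodWeight w 1 v)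
    summand v = begin
      guard (tuple? v) (T v)
        ≡⟨ guard-⇔ (tuple? v) (isPartition? (suc j) n 1 v)
             (λ (Σ≡ , ws≡) → Σ≡ , ≡.trans (≡.sym (wsum≡weightedSum v)) ws≡)
             (λ (Σ≡ , ws≡) → Σ≡ , ≡.trans (wsum≡weightedSum v) ws≡) ⟩
      guard (isPartition? (suc j) n 1 v) (T v)
        ≈⟨ guard-cong (isPartition? (suc j) n 1 v) (T≈ v) ⟩
      guard (isPartition? (suc j) n 1 v) (ι (n !) * prodWeight w 1 v)
        ≈⟨ guard-*ˡ (isPartition? (suc j) n 1 v) (ι (n !)) ⟩
      ι (n !) * guard (isPartition? (suc j) n 1 v) (prodWeight w 1 v) ∎

  fall*ι[k∸j]!≈ι[k!] : ∀ {k j} → j ≤ k → fall (+ k) j * ι ((k ∸ j) !) ≈ ι (k !)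
  fall*ι[k∸j]!≈ι[k!] {k} {zero}  _   = *-identityˡ _
  fall*ι[k∸j]!≈ι[k!] {k} {suc j} j<k = begin
    (fall (+ k) j * ιℤ (+ k ℤ.- + j)) * ι ((k ∸ suc j) !)
      ≡⟨ cong (λ t → (fall (+ k) j * ιℤ t) * ι ((k ∸ suc j) !)) (+m-+n≡+[m∸n] (ℕₚ.<⇒≤ j<k)) ⟩
    (fall (+ k) j * ι (k ∸ j)) * ι ((k ∸ suc j) !)
      ≈⟨ *-assoc _ _ _ ⟩
    fall (+ k) j * (ι (k ∸ j) * ι ((k ∸ suc j) !))
      ≈⟨ *-congˡ (ι-* (k ∸ j) ((k ∸ suc j) !)) ⟨
    fall (+ k) j * ι ((k ∸ j) ℕ.* (k ∸ suc j) !)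
      ≡⟨ cong (λ t → fall (+ k) j * ι t) [k∸j]!≡[k∸j]*[k∸1+j]! ⟨
    fall (+ k) j * ι ((k ∸ j) !)
      ≈⟨ fall*ι[k∸j]!≈ι[k!] (ℕₚ.<⇒≤ j<k) ⟩
    ι (k !) ∎
    where
    k∸j≡1+[k∸1+j] : k ∸ j ≡ suc (k ∸ suc j)
    k∸j≡1+[k∸1+j] = ℕₚ.+-∸-assoc 1 j<k
    [k∸j]!≡[k∸j]*[k∸1+j]! : (k ∸ j) ! ≡ (k ∸ j) ℕ.* (k ∸ suc j) !
    [k∸j]!≡[k∸j]*[k∸1+j]! = ≡.trans (cong _! k∸j≡1+[k∸1+j]) (cong (ℕ._* (k ∸ suc j) !) (≡.sym k∸j≡1+[k∸1+j]))

  fall≈ι[k!]*ι[[k∸j]!]⁻¹ : ∀ {k j} → j ≤ k → fall (+ k) j ≈ ι (k !) * ι ((k ∸ j) !) ⁻¹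
  fall≈ι[k!]*ι[[k∸j]!]⁻¹ {k} {j} j≤k = ≈ι*ι⁻¹ (k !) ((k ∸ j) !) {{ℕₚ._!≢0 (k ∸ j)}} (fall*ι[k∸j]!≈ι[k!] j≤k)

  k<j⇒fall≈0 : ∀ {k j} → k < j → fall (+ k) j ≈ 0#
  k<j⇒fall≈0 {k} {suc j} (s≤s k≤j) with ℕₚ.m≤n⇒m<n∨m≡n k≤j
  ... | inj₁ k<j    = trans (*-congʳ (k<j⇒fall≈0 k<j)) (zeroˡ _)
  ... | inj₂ ≡.refl = trans (*-congˡ (reflexive (≡.trans (cong ιℤ (+m-+n≡+[m∸n] {k} {k} ℕₚ.≤-refl)) (cong ι (ℕₚ.n∸n≡0 k)))))
                            (zeroʳ (fall (+ k) k))

  potentialTerm : (ℕ → Carrier) → (m k j : ℕ) → Carrier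
  potentialTerm y m k j = fall (+ k) j * ipow (y 0) (+ k ℤ.- + j) * (ι (m !) * partSum (bellWeight y) 1 m j m)

  Phat≈sumTo-potentialTerm : ∀ y m k → Phat m (+ k) y ≈ sumTo (suc m) (potentialTerm y m k)
  Phat≈sumTo-potentialTerm y m k = begin
    Phat m (+ k) y
      ≡⟨ sumL-map-upTo (λ j → fall (+ k) j * ipow (y 0) (+ k ℤ.- + j) * B m j y) (suc m) ⟩
    sumTo (suc m) (λ j → fall (+ k) j * ipow (y 0) (+ k ℤ.- + j) * B m j y)
      ≈⟨ sumTo-cong (suc m) (λ j _ → *-congˡ {fall (+ k) j * ipow (y 0) (+ k ℤ.- + j)} (bell≈partSum y m j)) ⟩
    sumTo (suc m) (potentialTerm y m k) ∎

  potentialTerm≈0 : ∀ y m k j → k < j ⊎ m < j → potentialTerm y m k j ≈ 0#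
  potentialTerm≈0 y m k j (inj₁ k<j) = trans (*-congʳ (trans (*-congʳ (k<j⇒fall≈0 k<j)) (zeroˡ _))) (zeroˡ _)
  potentialTerm≈0 y m k j (inj₂ m<j) = trans (*-congˡ (trans (*-congˡ partSum≈0) (zeroʳ _))) (zeroʳ _)
    where
    partSum≈0 : partSum (bellWeight y) 1 m j m ≈ 0#
    partSum≈0 = N<a*K⇒partSum≈0 (bellWeight y) 1 m (≡.subst (m <_) (≡.sym (ℕₚ.*-identityˡ j)) m<j)

  -- Removing the k ∸ j parts equal to 1 leaves j parts ≥ 2 of total (n ∸ k) + j; lowering each
  -- of them by 1 (partSum-shift) turns bellWeight x into bellWeight (shift x).
  partSum-removeOnes : ∀ x {n k} → 1 ≤ k → k ≤ n →
    partSum (bellWeight x) 1 n k n ≈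
      sumTo (suc k) (λ j → bellWeight x 1 (k ∸ j) * partSum (bellWeight (shift x)) 1 (n ∸ k) j (n ∸ k))
  partSum-removeOnes x {n@(suc n′)} {k@(suc k′)} (s≤s z≤n) k≤n@(s≤s k′≤n′) =
    trans (sumTo-reverse k onesTerm) (sumTo-cong (suc k) λ j j<1+k → removeOnes j (s≤s⁻¹ j<1+k))
    where
    m : ℕ
    m = n ∸ k
    w w′ : Weight
    w = bellWeight x
    w′ = bellWeight (shift x)
    onesTerm : ℕ → Carrier
    onesTerm r = guard (1 ℕ.* r ≤? n) (w 1 r * partSum w 2 n′ (k ∸ r) (n ∸ 1 ℕ.* r))
    removeOnes : ∀ j → j ≤ k → onesTerm (k ∸ j) ≈ w 1 (k ∸ j) * partSum w′ 1 m j m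
    removeOnes j j≤k = begin
      guard (1 ℕ.* (k ∸ j) ≤? n) (w 1 (k ∸ j) * partSum w 2 n′ (k ∸ (k ∸ j)) (n ∸ 1 ℕ.* (k ∸ j)))
        ≡⟨ guard-yes (1 ℕ.* (k ∸ j) ≤? n)
             (≡.subst (ℕ._≤ n) (≡.sym (ℕₚ.*-identityˡ (k ∸ j))) (ℕₚ.≤-trans (ℕₚ.m∸n≤m k j) k≤n)) ⟩
      w 1 (k ∸ j) * partSum w 2 n′ (k ∸ (k ∸ j)) (n ∸ 1 ℕ.* (k ∸ j))
        ≡⟨ cong₂ (λ K N → w 1 (k ∸ j) * partSum w 2 n′ K N) (ℕₚ.m∸[m∸n]≡n j≤k)
             (≡.trans (cong (n ∸_) (ℕₚ.*-identityˡ (k ∸ j))) (m∸[n∸o]≡[m∸n]+o j≤k k≤n)) ⟩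
      w 1 (k ∸ j) * partSum w 2 n′ j (m ℕ.+ j)
        ≈⟨ *-congˡ (partSum-shift (bellWeight-suc x) 1 n′ j m) ⟩
      w 1 (k ∸ j) * partSum w′ 1 n′ j m
        ≡⟨ cong (λ l → w 1 (k ∸ j) * partSum w′ 1 l j m) (ℕₚ.m∸n+n≡m k′≤n′) ⟨
      w 1 (k ∸ j) * partSum w′ 1 (m ℕ.+ k′) j m
        ≈⟨ *-congˡ (partSum-unusedSizes w′ 1 m k′ (λ i → bellWeight-zero (shift x) i) (ℕₚ.n<1+n m)) ⟩
      w 1 (k ∸ j) * partSum w′ 1 m j m ∎

  -- bellWeight x 1 r is definitionally y₀ ^ r / r!, since 1 ! reduces to 1.
  n!*bellWeight≈nCk*fall*ipow*[n∸k]! : ∀ x {n k j} → j ≤ k → k ≤ n → ∀ s →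
    ι (n !) * (bellWeight x 1 (k ∸ j) * s) ≈
      ι (n C k) * (fall (+ k) j * ipow (shift x 0) (+ k ℤ.- + j) * (ι ((n ∸ k) !) * s))
  n!*bellWeight≈nCk*fall*ipow*[n∸k]! x {n} {k} {j} j≤k k≤n s = begin
    ι (n !) * ((pow y₀ r * ι (r !) ⁻¹) * s)
      ≈⟨ *-congʳ ι[n!]≈ ⟩
    (ι (n C k) * (ι (k !) * ι (m !))) * ((pow y₀ r * ι (r !) ⁻¹) * s)
      ≈⟨ Solver.solve 6 (λ C K M P R S → (C ⊕ (K ⊕ M)) ⊕ ((P ⊕ R) ⊕ S) ⊜ C ⊕ (((K ⊕ R) ⊕ P) ⊕ (M ⊕ S))) refl
           (ι (n C k)) (ι (k !)) (ι (m !)) (pow y₀ r) (ι (r !) ⁻¹) s ⟩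
    ι (n C k) * (((ι (k !) * ι (r !) ⁻¹) * pow y₀ r) * (ι (m !) * s))
      ≈⟨ *-congˡ (*-congʳ (*-cong (sym (fall≈ι[k!]*ι[[k∸j]!]⁻¹ j≤k)) (reflexive (cong (ipow y₀) (≡.sym (+m-+n≡+[m∸n] j≤k)))))) ⟩
    ι (n C k) * (fall (+ k) j * ipow y₀ (+ k ℤ.- + j) * (ι (m !) * s)) ∎
    where
    open Solver using (_⊕_; _⊜_)
    y₀ : Carrier
    y₀ = shift x 0
    r m : ℕ
    r = k ∸ j
    m = n ∸ k
    ι[n!]≈ : ι (n !) ≈ ι (n C k) * (ι (k !) * ι (m !))
    ι[n!]≈ = trans (reflexive (cong ι (n!≡nCk*[k!*[n∸k]!] k≤n))) (trans (ι-* (n C k) _) (*-congˡ (ι-* (k !) (m !))))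

corollary3p19 : {c ℓ : Level} (F : CharZeroField c ℓ) (x : ℕ → CharZeroField.Carrier F) (n k : ℕ) →
    1 ≤ k → k ≤ n →
    CharZeroField._≈_ F (Ops.B F n k x)
    (CharZeroField._*_ F (CharZeroField.ι F (n C k))
    (Ops.Phat F (n ∸ k) (+ k) (λ i → CharZeroField._*_ F (x (suc i)) (CharZeroField._⁻¹ F (CharZeroField.ι F (suc i))))))
corollary3p19 F x n k 1≤k k≤n = begin
  B n k x
    ≈⟨ bell≈partSum x n k ⟩
  ι (n !) * partSum (bellWeight x) 1 n k n
    ≈⟨ *-congˡ (partSum-removeOnes x 1≤k k≤n) ⟩
  ι (n !) * sumTo (suc k) (λ j → bellWeight x 1 (k ∸ j) * S j)
    ≈⟨ sumTo-*ˡ (suc k) (ι (n !)) (λ j → bellWeight x 1 (k ∸ j) * S j) ⟨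
  sumTo (suc k) (λ j → ι (n !) * (bellWeight x 1 (k ∸ j) * S j))
    ≈⟨ sumTo-cong (suc k) (λ j j<1+k → n!*bellWeight≈nCk*fall*ipow*[n∸k]! x (s≤s⁻¹ j<1+k) k≤n (S j)) ⟩
  sumTo (suc k) (λ j → ι (n C k) * potentialTerm y m k j)
    ≈⟨ sumTo-*ˡ (suc k) (ι (n C k)) (potentialTerm y m k) ⟩
  ι (n C k) * sumTo (suc k) (potentialTerm y m k)
    ≈⟨ *-congˡ (sumTo-vanishing (λ j → potentialTerm≈0 y m k j ∘ inj₁) (λ j → potentialTerm≈0 y m k j ∘ inj₂)) ⟩
  ι (n C k) * sumTo (suc m) (potentialTerm y m k)
    ≈⟨ *-congˡ (Phat≈sumTo-potentialTerm y m k) ⟨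
  ι (n C k) * Phat m (+ k) y ∎
  where
  open CharZeroField F
  open Ops F
  open Sums F
  open PartitionSums F
  open BellPolynomials F
  open SetoidReasoning setoid
  m : ℕ
  m = n ∸ k
  y : ℕ → Carrier
  y = shift x
  S : ℕ → Carrier
  S j = partSum (bellWeight y) 1 m j m
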